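{- Let $G$ be a finite simple graph with $\ker(G)=\emptyset$, let $A$ be a critical independent set of $G$, and let $\Lambda=\{S\in\Omega(G): A\cap S=\emptyset\}$, assumed nonempty. Then $\left|\bigcap\Lambda\right|\ge |A|$.
   Context: For $X\subseteq V(G)$, $N(X)$ is the set of vertices adjacent to some vertex of $X$, $d(X)=|X|-|N(X)|$. An independent set $A$ (no two vertices adjacent) is a critical independent set if $d(A)=\max\{d(I): I \text{ independent in } G\}$. $\ker(G)$ is the intersection of all critical independent sets of $G$. $\Omega(G)$ is the family of all maximum-cardinality independent sets of $G$, and $\bigcap\Lambda$ is the intersection of the members of $\Lambda$. -}

module Defs where

open import Data.Nat using (ℕ)
open import Data.Integer using (ℤ; _-_; _≤_; +_)
open import Data.Fin using (Fin)
open import Data.Fin.Subset public using (Subset; _∈_; _∉_; ∣_∣)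
open import Data.Product using (Σ; ∃; _×_; _,_)
open import Relation.Nullary using (¬_)
open import Relation.Binary.PropositionalEquality using (_≡_)
open import Relation.Binary.Definitions using (Decidable)

record Graph (n : ℕ) : Set₁ where
  field
    Adj     : Fin n → Fin n → Set
    adj?    : Decidable Adj
    irrefl  : ∀ u → ¬ Adj u u
    sym     : ∀ {u v} → Adj u v → Adj v u
open Graph public

module _ {n : ℕ} (G : Graph n) where

  Independent : Subset n → Set
  Independent X = ∀ u v → u ∈ X → v ∈ X → ¬ Adj G u v

  N : Subset n → Subset n
  N X = tabulateN
    where
    open import Data.Vec using (tabulate)
    open import Data.Fin.Properties using (any?)
    open import Data.Fin.Subset.Properties using (_∈?_)
    open import Relation.Nullary.Decidable using (_×-dec_)
    tabulateN : Subset n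
    tabulateN = tabulate λ v → Relation.Nullary.Decidable.isYes
                  (any? λ u → (u ∈? X) ×-dec adj? G u v)

  d : Subset n → ℤ
  d X = + ∣ X ∣ - + ∣ N X ∣

  CriticalIndependent : Subset n → Set
  CriticalIndependent A = Independent A × (∀ I → Independent I → d I ≤ d A)

  KerEmpty : Set
  KerEmpty = ∀ v → ¬ (∀ A → CriticalIndependent A → v ∈ A)

  MaximumIndependent : Subset n → Set
  MaximumIndependent S = Independent S × (∀ I → Independent I → ∣ I ∣ Data.Nat.≤ ∣ S ∣)

  Disjoint : Subset n → Subset n → Set
  Disjoint A S = ∀ v → v ∈ A → v ∉ S

  InΛ : Subset n → Subset n → Set
  InΛ A S = MaximumIndependent S × Disjoint A S

-- If ker G = ∅ then |X| ≤ |N(X)| for every independent X.  Indeed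
-- d(X) + d(Y) ≤ d(X ∩ Y) + d((X ∖ N(Y)) ∪ (Y ∖ N(X))) for independent X, Y, so
-- intersecting an independent set of positive surplus |X| - |N(X)| with a
-- critical set keeps the surplus positive; a ⊂-minimal such set would then lie
-- inside every critical set.  Comparing A with ∅ gives |N(A)| ≤ |A| too.  Every
-- maximum independent S disjoint from A contains N(A), since otherwise
-- (S ∖ N(A)) ∪ A would be a larger independent set.  So |⋂Λ| ≥ |N(A)| ≥ |A|.
module Submission where

open import Data.Nat using (ℕ; suc; _+_; _≤_; _<_; _≥_; z≤n)
open import Data.Nat.Properties
open import Data.Nat.Tactic.RingSolver as ℕ-Solver using ()
open import Algebra.Properties.CommutativeSemigroup +-commutativeSemigroup using (interchange)
import Data.Integer as ℤ
import Data.Integer.Properties as ℤ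
import Data.Integer.Tactic.RingSolver as ℤ-Solver
open import Data.Fin using (Fin)
open import Data.Fin.Subset renaming (⊥ to ∅)
open import Data.Fin.Subset.Properties
open import Data.Fin.Subset.Induction using (⊂-wellFounded)
open import Data.Vec using (_∷_; []; there)
open import Data.Vec.Properties using (lookup∘tabulate; []=⇒lookup; lookup⇒[]=)
open import Data.Bool.Properties using (T-≡)
open import Data.Product using (∃; _×_; _,_; proj₁; proj₂)
open import Data.Sum using (_⊎_; inj₁; inj₂)
import Data.Sum as Sum
open import Data.Empty using (⊥-elim)
open import Function.Base using (id; _∘_)
open import Function.Bundles using (Equivalence; _⇔_)
open import Induction.WellFounded using (Acc; acc)
open import Relation.Nullary using (¬_; yes; no; contradiction)
open import Relation.Nullary.Decidable using (toWitness; fromWitness)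
open import Relation.Binary.PropositionalEquality

open import Defs hiding (sym)

private variable
  n : ℕ

∣p∪q∣+∣p∩q∣≡∣p∣+∣q∣ : ∀ (p q : Subset n) → ∣ p ∪ q ∣ + ∣ p ∩ q ∣ ≡ ∣ p ∣ + ∣ q ∣
∣p∪q∣+∣p∩q∣≡∣p∣+∣q∣ []            []            = refl
∣p∪q∣+∣p∩q∣≡∣p∣+∣q∣ (inside  ∷ p) (inside  ∷ q) =
  cong suc (trans (+-suc _ _) (trans (cong suc (∣p∪q∣+∣p∩q∣≡∣p∣+∣q∣ p q)) (sym (+-suc _ _))))
∣p∪q∣+∣p∩q∣≡∣p∣+∣q∣ (inside  ∷ p) (outside ∷ q) = cong suc (∣p∪q∣+∣p∩q∣≡∣p∣+∣q∣ p q)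
∣p∪q∣+∣p∩q∣≡∣p∣+∣q∣ (outside ∷ p) (inside  ∷ q) =
  trans (cong suc (∣p∪q∣+∣p∩q∣≡∣p∣+∣q∣ p q)) (sym (+-suc _ _))
∣p∪q∣+∣p∩q∣≡∣p∣+∣q∣ (outside ∷ p) (outside ∷ q) = ∣p∪q∣+∣p∩q∣≡∣p∣+∣q∣ p q

Empty⇒∣p∣≡0 : ∀ {p : Subset n} → Empty p → ∣ p ∣ ≡ 0
Empty⇒∣p∣≡0 {n} p-empty = trans (cong ∣_∣ (Empty-unique p-empty)) (∣⊥∣≡0 n)

∣p∪q∣≤∣p∣+∣q∣ : ∀ (p q : Subset n) → ∣ p ∪ q ∣ ≤ ∣ p ∣ + ∣ q ∣
∣p∪q∣≤∣p∣+∣q∣ p q = subst (∣ p ∪ q ∣ ≤_) (∣p∪q∣+∣p∩q∣≡∣p∣+∣q∣ p q) (m≤m+n _ _)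

Empty[p∩q]⇒∣p∪q∣≡∣p∣+∣q∣ : ∀ (p q : Subset n) → Empty (p ∩ q) → ∣ p ∪ q ∣ ≡ ∣ p ∣ + ∣ q ∣
Empty[p∩q]⇒∣p∪q∣≡∣p∣+∣q∣ p q p∩q-empty = begin
  ∣ p ∪ q ∣              ≡⟨ +-identityʳ _ ⟨
  ∣ p ∪ q ∣ + 0          ≡⟨ cong (∣ p ∪ q ∣ +_) (Empty⇒∣p∣≡0 p∩q-empty) ⟨
  ∣ p ∪ q ∣ + ∣ p ∩ q ∣  ≡⟨ ∣p∪q∣+∣p∩q∣≡∣p∣+∣q∣ p q ⟩
  ∣ p ∣ + ∣ q ∣          ∎
  where open ≡-Reasoning

x∈p─q⇒x∉q : ∀ {x : Fin n} (p q : Subset n) → x ∈ p ─ q → x ∉ q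
x∈p─q⇒x∉q (_ ∷ p) (_ ∷ q) (there x∈p─q) (there x∈q) = x∈p─q⇒x∉q p q x∈p─q x∈q

x∈p⇒x∈p─q⊎x∈q : ∀ {x : Fin n} {p} q → x ∈ p → x ∈ p ─ q ⊎ x ∈ q
x∈p⇒x∈p─q⊎x∈q {x = x} q x∈p with x ∈? q
... | yes x∈q = inj₂ x∈q
... | no  x∉q = inj₁ (x∈p∧x∉q⇒x∈p─q x∈p x∉q)

0<∣p∣⇒Nonempty : ∀ (p : Subset n) → 0 < ∣ p ∣ → Nonempty p
0<∣p∣⇒Nonempty p 0<∣p∣ with nonempty? p
... | yes p-nonempty = p-nonempty
... | no  p-empty    = contradiction (Empty⇒∣p∣≡0 p-empty) (>⇒≢ 0<∣p∣)

module _ {n : ℕ} (G : Graph n) where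

  private variable
    X Y : Subset n
    u v : Fin n

  ∈N⁺ : u ∈ X → Adj G u v → v ∈ N G X
  ∈N⁺ {u} {X} {v} u∈X u~v =
    lookup⇒[]= v _ (trans (lookup∘tabulate _ v) (T-≡ .Equivalence.to (fromWitness (u , u∈X , u~v))))

  ∈N⁻ : v ∈ N G X → ∃ λ u → u ∈ X × Adj G u v
  ∈N⁻ {v} v∈NX = toWitness (T-≡ .Equivalence.from (trans (sym (lookup∘tabulate _ v)) ([]=⇒lookup v∈NX)))

  d≤d⇒∣X∣+∣N[Y]∣≤∣Y∣+∣N[X]∣ : ∀ X Y → d G X ℤ.≤ d G Y → ∣ X ∣ + ∣ N G Y ∣ ≤ ∣ Y ∣ + ∣ N G X ∣
  d≤d⇒∣X∣+∣N[Y]∣≤∣Y∣+∣N[X]∣ X Y dX≤dY = ℤ.drop‿+≤+ (begin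
    ℤ.+ (x + nY)                         ≡⟨ ℤ.pos-+ x nY ⟩
    ℤ.+ x ℤ.+ ℤ.+ nY                      ≡⟨ a+c≡a-b+[b+c] (ℤ.+ x) (ℤ.+ nX) (ℤ.+ nY) ⟩
    d G X ℤ.+ (ℤ.+ nX ℤ.+ ℤ.+ nY)         ≤⟨ ℤ.+-monoˡ-≤ (ℤ.+ nX ℤ.+ ℤ.+ nY) dX≤dY ⟩
    d G Y ℤ.+ (ℤ.+ nX ℤ.+ ℤ.+ nY)         ≡⟨ a-c+[b+c]≡a+b (ℤ.+ y) (ℤ.+ nX) (ℤ.+ nY) ⟩
    ℤ.+ y ℤ.+ ℤ.+ nX                      ≡⟨ ℤ.pos-+ y nX ⟨
    ℤ.+ (y + nX)                         ∎)
    where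
    open ℤ.≤-Reasoning
    x y nX nY : ℕ
    x = ∣ X ∣
    y = ∣ Y ∣
    nX = ∣ N G X ∣
    nY = ∣ N G Y ∣
    a+c≡a-b+[b+c] : ∀ a b c → a ℤ.+ c ≡ (a ℤ.- b) ℤ.+ (b ℤ.+ c)
    a+c≡a-b+[b+c] = ℤ-Solver.solve-∀
    a-c+[b+c]≡a+b : ∀ a b c → (a ℤ.- c) ℤ.+ (b ℤ.+ c) ≡ a ℤ.+ b
    a-c+[b+c]≡a+b = ℤ-Solver.solve-∀

  N-mono : X ⊆ Y → N G X ⊆ N G Y
  N-mono X⊆Y v∈NX with ∈N⁻ v∈NX
  ... | u , u∈X , u~v = ∈N⁺ (X⊆Y u∈X) u~v

  ∣N∅∣≡0 : ∣ N G ∅ ∣ ≡ 0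
  ∣N∅∣≡0 = Empty⇒∣p∣≡0 λ (v , v∈N∅) → ∉⊥ (proj₁ (proj₂ (∈N⁻ v∈N∅)))

  ⊆-independent : X ⊆ Y → Independent G Y → Independent G X
  ⊆-independent X⊆Y Y-ind u v u∈X v∈X = Y-ind u v (X⊆Y u∈X) (X⊆Y v∈X)

  ∪-independent : Independent G X → Independent G Y →
                  (∀ {u v} → u ∈ X → v ∈ Y → ¬ Adj G u v) → Independent G (X ∪ Y)
  ∪-independent {X} {Y} X-ind Y-ind no-edge u v u∈X∪Y v∈X∪Y u~v
    with x∈p∪q⁻ X Y u∈X∪Y | x∈p∪q⁻ X Y v∈X∪Y
  ... | inj₁ u∈X | inj₁ v∈X = X-ind u v u∈X v∈X u~v
  ... | inj₁ u∈X | inj₂ v∈Y = no-edge u∈X v∈Y u~v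
  ... | inj₂ u∈Y | inj₁ v∈X = no-edge v∈X u∈Y (Graph.sym G u~v)
  ... | inj₂ u∈Y | inj₂ v∈Y = Y-ind u v u∈Y v∈Y u~v

  ─N-no-edge : u ∈ X → v ∈ Y ─ N G X → ¬ Adj G u v
  ─N-no-edge u∈X v∈Y─NX u~v = x∈p─q⇒x∉q _ _ v∈Y─NX (∈N⁺ u∈X u~v)

  N-∪ : N G (X ∪ Y) ⊆ N G X ∪ N G Y
  N-∪ {X} {Y} v∈N[X∪Y] with ∈N⁻ v∈N[X∪Y]
  ... | u , u∈X∪Y , u~v = x∈p∪q⁺ (Sum.map (λ u∈X → ∈N⁺ u∈X u~v) (λ u∈Y → ∈N⁺ u∈Y u~v) (x∈p∪q⁻ X Y u∈X∪Y))

  exchange : Subset n → Subset n → Subset n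
  exchange X Y = (X ─ N G Y) ∪ (Y ─ N G X)

  exchange-comm : ∀ X Y → exchange X Y ≡ exchange Y X
  exchange-comm X Y = ∪-comm (X ─ N G Y) (Y ─ N G X)

  exchange⊆∪ : exchange X Y ⊆ X ∪ Y
  exchange⊆∪ {X} {Y} u∈XY = x∈p∪q⁺ (Sum.map (p─q⊆p X _) (p─q⊆p Y _) (x∈p∪q⁻ _ _ u∈XY))

  exchange-independent : Independent G X → Independent G Y → Independent G (exchange X Y)
  exchange-independent {X} {Y} X-ind Y-ind =
    ∪-independent (⊆-independent (p─q⊆p X _) X-ind) (⊆-independent (p─q⊆p Y _) Y-ind)
      (λ u∈X─NY → ─N-no-edge (p─q⊆p X _ u∈X─NY))

  ∈N[exchange]⇒∉ : Independent G X → v ∈ N G (exchange X Y) → v ∉ X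
  ∈N[exchange]⇒∉ {X} {v} {Y} X-ind v∈N[XY] v∈X with ∈N⁻ v∈N[XY]
  ... | u , u∈XY , u~v with x∈p∪q⁻ (X ─ N G Y) (Y ─ N G X) u∈XY
  ...   | inj₁ u∈X─NY = X-ind u v (p─q⊆p X _ u∈X─NY) v∈X u~v
  ...   | inj₂ u∈Y─NX = ─N-no-edge v∈X u∈Y─NX (Graph.sym G u~v)

  -- d X + d Y ≤ d (X ∩ Y) + d (exchange X Y), with the subtracted terms moved across.
  exchange-supermodular : ∀ {X Y} → Independent G X → Independent G Y →
    ∣ X ∣ + ∣ N G (X ∩ Y) ∣ + (∣ Y ∣ + ∣ N G (exchange X Y) ∣) ≤
    ∣ X ∩ Y ∣ + ∣ N G X ∣ + (∣ exchange X Y ∣ + ∣ N G Y ∣)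
  exchange-supermodular {X} {Y} X-ind Y-ind = begin
    ∣ X ∣ + ∣ N G (X ∩ Y) ∣ + (∣ Y ∣ + ∣ N G E ∣)
      ≡⟨ interchange (∣ X ∣) _ (∣ Y ∣) _ ⟩
    ∣ X ∣ + ∣ Y ∣ + (∣ N G (X ∩ Y) ∣ + ∣ N G E ∣)
      ≡⟨ cong (_+ (∣ N G (X ∩ Y) ∣ + ∣ N G E ∣)) (∣p∪q∣+∣p∩q∣≡∣p∣+∣q∣ X Y) ⟨
    ∣ X ∪ Y ∣ + ∣ X ∩ Y ∣ + (∣ N G (X ∩ Y) ∣ + ∣ N G E ∣)
      ≤⟨ +-monoˡ-≤ (∣ N G (X ∩ Y) ∣ + ∣ N G E ∣) (+-monoˡ-≤ (∣ X ∩ Y ∣) ∣X∪Y∣≤∣E∣+∣Z∣) ⟩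
    ∣ E ∣ + ∣ Z ∣ + ∣ X ∩ Y ∣ + (∣ N G (X ∩ Y) ∣ + ∣ N G E ∣)
      ≡⟨ regroup (∣ E ∣) (∣ Z ∣) (∣ X ∩ Y ∣) (∣ N G (X ∩ Y) ∣) (∣ N G E ∣) ⟩
    ∣ X ∩ Y ∣ + ∣ E ∣ + (∣ N G (X ∩ Y) ∣ + (∣ Z ∣ + ∣ N G E ∣))
      ≤⟨ +-monoʳ-≤ (∣ X ∩ Y ∣ + ∣ E ∣) (+-monoʳ-≤ (∣ N G (X ∩ Y) ∣) ∣Z∣+∣N[E]∣≤∣W∣) ⟩
    ∣ X ∩ Y ∣ + ∣ E ∣ + (∣ N G (X ∩ Y) ∣ + ∣ W ∣)
      ≤⟨ +-monoʳ-≤ (∣ X ∩ Y ∣ + ∣ E ∣) ∣N[X∩Y]∣+∣W∣≤∣N[X]∣+∣N[Y]∣ ⟩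
    ∣ X ∩ Y ∣ + ∣ E ∣ + (∣ N G X ∣ + ∣ N G Y ∣)
      ≡⟨ interchange (∣ X ∩ Y ∣) _ _ _ ⟩
    ∣ X ∩ Y ∣ + ∣ N G X ∣ + (∣ E ∣ + ∣ N G Y ∣) ∎
    where
    open ≤-Reasoning
    E W Z : Subset n
    E = exchange X Y
    W = N G X ∪ N G Y
    Z = (X ∪ Y) ∩ W

    regroup : ∀ e z i ni ne → e + z + i + (ni + ne) ≡ i + e + (ni + (z + ne))
    regroup = ℕ-Solver.solve-∀

    X∪Y⊆E∪Z : X ∪ Y ⊆ E ∪ Z
    X∪Y⊆E∪Z x∈X∪Y with x∈p∪q⁻ X Y x∈X∪Y
    ... | inj₁ x∈X = x∈p∪q⁺ (Sum.map (λ x∈X─NY → x∈p∪q⁺ (inj₁ x∈X─NY))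
                                       (λ x∈NY → x∈p∩q⁺ (x∈X∪Y , x∈p∪q⁺ (inj₂ x∈NY)))
                                       (x∈p⇒x∈p─q⊎x∈q (N G Y) x∈X))
    ... | inj₂ x∈Y = x∈p∪q⁺ (Sum.map (λ x∈Y─NX → x∈p∪q⁺ (inj₂ x∈Y─NX))
                                       (λ x∈NX → x∈p∩q⁺ (x∈X∪Y , x∈p∪q⁺ (inj₁ x∈NX)))
                                       (x∈p⇒x∈p─q⊎x∈q (N G X) x∈Y))

    ∣X∪Y∣≤∣E∣+∣Z∣ : ∣ X ∪ Y ∣ ≤ ∣ E ∣ + ∣ Z ∣
    ∣X∪Y∣≤∣E∣+∣Z∣ = ≤-trans (p⊆q⇒∣p∣≤∣q∣ X∪Y⊆E∪Z) (∣p∪q∣≤∣p∣+∣q∣ E Z)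

    Z∩N[E]-empty : Empty (Z ∩ N G E)
    Z∩N[E]-empty (x , x∈Z∩NE) with x∈p∩q⁻ Z (N G E) x∈Z∩NE
    ... | x∈Z , x∈NE with x∈p∪q⁻ X Y (p∩q⊆p _ _ x∈Z)
    ...   | inj₁ x∈X = ∈N[exchange]⇒∉ X-ind x∈NE x∈X
    ...   | inj₂ x∈Y = ∈N[exchange]⇒∉ Y-ind (subst (λ F → x ∈ N G F) (exchange-comm X Y) x∈NE) x∈Y

    Z∪N[E]⊆W : Z ∪ N G E ⊆ W
    Z∪N[E]⊆W x∈Z∪NE with x∈p∪q⁻ Z (N G E) x∈Z∪NE
    ... | inj₁ x∈Z  = p∩q⊆q _ _ x∈Z
    ... | inj₂ x∈NE = N-∪ (N-mono exchange⊆∪ x∈NE)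

    ∣Z∣+∣N[E]∣≤∣W∣ : ∣ Z ∣ + ∣ N G E ∣ ≤ ∣ W ∣
    ∣Z∣+∣N[E]∣≤∣W∣ = subst (_≤ ∣ W ∣) (Empty[p∩q]⇒∣p∪q∣≡∣p∣+∣q∣ Z (N G E) Z∩N[E]-empty)
                              (p⊆q⇒∣p∣≤∣q∣ Z∪N[E]⊆W)

    ∣N[X∩Y]∣+∣W∣≤∣N[X]∣+∣N[Y]∣ : ∣ N G (X ∩ Y) ∣ + ∣ W ∣ ≤ ∣ N G X ∣ + ∣ N G Y ∣
    ∣N[X∩Y]∣+∣W∣≤∣N[X]∣+∣N[Y]∣ = begin
      ∣ N G (X ∩ Y) ∣ + ∣ W ∣        ≡⟨ +-comm _ (∣ W ∣) ⟩
      ∣ W ∣ + ∣ N G (X ∩ Y) ∣        ≤⟨ +-monoʳ-≤ (∣ W ∣) (p⊆q⇒∣p∣≤∣q∣ N[X∩Y]⊆N[X]∩N[Y]) ⟩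
      ∣ W ∣ + ∣ N G X ∩ N G Y ∣      ≡⟨ ∣p∪q∣+∣p∩q∣≡∣p∣+∣q∣ (N G X) (N G Y) ⟩
      ∣ N G X ∣ + ∣ N G Y ∣          ∎
      where
      N[X∩Y]⊆N[X]∩N[Y] : N G (X ∩ Y) ⊆ N G X ∩ N G Y
      N[X∩Y]⊆N[X]∩N[Y] v∈ = x∈p∩q⁺ (N-mono (p∩q⊆p X Y) v∈ , N-mono (p∩q⊆q X Y) v∈)

  surplus-∩-critical : ∀ {X Y} → Independent G X → CriticalIndependent G Y →
                       ∣ N G X ∣ < ∣ X ∣ → ∣ N G (X ∩ Y) ∣ < ∣ X ∩ Y ∣
  surplus-∩-critical {X} {Y} X-ind (Y-ind , Y-max) surplus =
    +-cancelʳ-< (∣ X ∣) (∣ N G (X ∩ Y) ∣) (∣ X ∩ Y ∣) (begin-strict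
      ∣ N G (X ∩ Y) ∣ + ∣ X ∣  ≡⟨ +-comm (∣ N G (X ∩ Y) ∣) (∣ X ∣) ⟩
      ∣ X ∣ + ∣ N G (X ∩ Y) ∣  ≤⟨ ∣X∣+∣N[X∩Y]∣≤∣X∩Y∣+∣N[X]∣ ⟩
      ∣ X ∩ Y ∣ + ∣ N G X ∣    <⟨ +-monoʳ-< (∣ X ∩ Y ∣) surplus ⟩
      ∣ X ∩ Y ∣ + ∣ X ∣        ∎)
    where
    open ≤-Reasoning
    E : Subset n
    E = exchange X Y

    ∣E∣+∣N[Y]∣≤∣Y∣+∣N[E]∣ : ∣ E ∣ + ∣ N G Y ∣ ≤ ∣ Y ∣ + ∣ N G E ∣
    ∣E∣+∣N[Y]∣≤∣Y∣+∣N[E]∣ = d≤d⇒∣X∣+∣N[Y]∣≤∣Y∣+∣N[X]∣ E Y (Y-max E (exchange-independent X-ind Y-ind))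

    ∣X∣+∣N[X∩Y]∣≤∣X∩Y∣+∣N[X]∣ : ∣ X ∣ + ∣ N G (X ∩ Y) ∣ ≤ ∣ X ∩ Y ∣ + ∣ N G X ∣
    ∣X∣+∣N[X∩Y]∣≤∣X∩Y∣+∣N[X]∣ = +-cancelʳ-≤ (∣ Y ∣ + ∣ N G E ∣) _ _ (begin
      ∣ X ∣ + ∣ N G (X ∩ Y) ∣ + (∣ Y ∣ + ∣ N G E ∣)  ≤⟨ exchange-supermodular X-ind Y-ind ⟩
      ∣ X ∩ Y ∣ + ∣ N G X ∣ + (∣ E ∣ + ∣ N G Y ∣)    ≤⟨ +-monoʳ-≤ (∣ X ∩ Y ∣ + ∣ N G X ∣) ∣E∣+∣N[Y]∣≤∣Y∣+∣N[E]∣ ⟩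
      ∣ X ∩ Y ∣ + ∣ N G X ∣ + (∣ Y ∣ + ∣ N G E ∣)    ∎)

  kerEmpty⇒∣X∣≤∣N[X]∣ : KerEmpty G → ∀ {X} → Independent G X → ∣ X ∣ ≤ ∣ N G X ∣
  kerEmpty⇒∣X∣≤∣N[X]∣ ker-empty {X} X-ind = ≮⇒≥ (no-surplus X (⊂-wellFounded X) X-ind)
    where
    no-surplus : ∀ X → Acc _⊂_ X → Independent G X → ¬ (∣ N G X ∣ < ∣ X ∣)
    no-surplus X (acc smaller) X-ind surplus with 0<∣p∣⇒Nonempty X (≤-<-trans z≤n surplus)
    ... | v , v∈X = ker-empty v v∈every-critical
      where
      v∈every-critical : ∀ Y → CriticalIndependent G Y → v ∈ Y
      v∈every-critical Y Y-crit with v ∈? Y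
      ... | yes v∈Y = v∈Y
      ... | no  v∉Y = ⊥-elim (no-surplus (X ∩ Y) (smaller X∩Y⊂X)
                                (⊆-independent (p∩q⊆p X Y) X-ind)
                                (surplus-∩-critical X-ind Y-crit surplus))
        where
        X∩Y⊂X : X ∩ Y ⊂ X
        X∩Y⊂X = p∩q⊆p X Y , v , v∈X , v∉Y ∘ proj₂ ∘ x∈p∩q⁻ X Y

  critical⇒∣N[X]∣≤∣X∣ : ∀ {X} → CriticalIndependent G X → ∣ N G X ∣ ≤ ∣ X ∣
  critical⇒∣N[X]∣≤∣X∣ {X} (_ , X-max) =
    subst₂ _≤_ (cong (_+ ∣ N G X ∣) (∣⊥∣≡0 n)) (trans (cong (∣ X ∣ +_) ∣N∅∣≡0) (+-identityʳ _))
      (d≤d⇒∣X∣+∣N[Y]∣≤∣Y∣+∣N[X]∣ ∅ X (X-max ∅ (λ u _ u∈∅ → contradiction u∈∅ ∉⊥)))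

  N⊆disjoint-maximum : ∀ {A S} → Independent G A → ∣ N G A ∣ ≤ ∣ A ∣ →
              MaximumIndependent G S → Disjoint G A S → N G A ⊆ S
  N⊆disjoint-maximum {A} {S} A-ind ∣N[A]∣≤∣A∣ (S-ind , S-max) A∩S-empty {v} v∈NA with v ∈? S
  ... | yes v∈S = v∈S
  ... | no  v∉S = contradiction (S-max S′ S′-ind) (<⇒≱ ∣S∣<∣S′∣)
    where
    S′ : Subset n
    S′ = (S ─ N G A) ∪ A

    S′-ind : Independent G S′
    S′-ind = ∪-independent (⊆-independent (p─q⊆p S _) S-ind) A-ind
               (λ u∈S─NA v∈A u~v → ─N-no-edge v∈A u∈S─NA (Graph.sym G u~v))

    S⊆[S─NA]∪[S∩NA] : S ⊆ (S ─ N G A) ∪ (S ∩ N G A)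
    S⊆[S─NA]∪[S∩NA] x∈S =
      x∈p∪q⁺ (Sum.map id (λ x∈NA → x∈p∩q⁺ (x∈S , x∈NA)) (x∈p⇒x∈p─q⊎x∈q (N G A) x∈S))

    S∩NA⊂NA : S ∩ N G A ⊂ N G A
    S∩NA⊂NA = p∩q⊆q S (N G A) , v , v∈NA , v∉S ∘ p∩q⊆p S (N G A)

    [S─NA]∩A-empty : Empty ((S ─ N G A) ∩ A)
    [S─NA]∩A-empty (x , x∈) with x∈p∩q⁻ (S ─ N G A) A x∈
    ... | x∈S─NA , x∈A = A∩S-empty x x∈A (p─q⊆p S _ x∈S─NA)

    ∣S∣<∣S′∣ : ∣ S ∣ < ∣ S′ ∣
    ∣S∣<∣S′∣ = begin-strict
      ∣ S ∣                                ≤⟨ p⊆q⇒∣p∣≤∣q∣ S⊆[S─NA]∪[S∩NA] ⟩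
      ∣ (S ─ N G A) ∪ (S ∩ N G A) ∣        ≤⟨ ∣p∪q∣≤∣p∣+∣q∣ (S ─ N G A) (S ∩ N G A) ⟩
      ∣ S ─ N G A ∣ + ∣ S ∩ N G A ∣        <⟨ +-monoʳ-< (∣ S ─ N G A ∣) (p⊂q⇒∣p∣<∣q∣ S∩NA⊂NA) ⟩
      ∣ S ─ N G A ∣ + ∣ N G A ∣            ≤⟨ +-monoʳ-≤ (∣ S ─ N G A ∣) ∣N[A]∣≤∣A∣ ⟩
      ∣ S ─ N G A ∣ + ∣ A ∣                ≡⟨ Empty[p∩q]⇒∣p∪q∣≡∣p∣+∣q∣ (S ─ N G A) A [S─NA]∩A-empty ⟨
      ∣ S′ ∣                               ∎
      where open ≤-Reasoning

proposition3p2 : {n : ℕ} (G : Graph n) → KerEmpty G → (A : Subset n) → CriticalIndependent G A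
                 → ∃ (λ S → InΛ G A S)
                 → (T : Subset n) → (∀ v → (v ∈ T) ⇔ (∀ S → InΛ G A S → v ∈ S))
                 → ∣ T ∣ ≥ ∣ A ∣
proposition3p2 G ker-empty A A-crit@(A-ind , _) _ T T≡⋂Λ = begin
  ∣ A ∣      ≤⟨ kerEmpty⇒∣X∣≤∣N[X]∣ G ker-empty A-ind ⟩
  ∣ N G A ∣  ≤⟨ p⊆q⇒∣p∣≤∣q∣ N[A]⊆T ⟩
  ∣ T ∣      ∎
  where
  open ≤-Reasoning
  N[A]⊆T : N G A ⊆ T
  N[A]⊆T {v} v∈NA = Equivalence.from (T≡⋂Λ v) λ S (S-max , A∩S-empty) →
    N⊆disjoint-maximum G A-ind (critical⇒∣N[X]∣≤∣X∣ G A-crit) S-max A∩S-empty v∈NA
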